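{- Let $d$ be a power of $2$, let $X\subseteq\{0,1\}^d$ be a finite set, let $T$ be any quadtree and let $G$ be any spanning tree of $X$. Then \[\mathrm{Value}_T(X)\le2\sum_{(x,y)\in E(G)}\mathrm{Pay}_T(x,y).\]
   Context: Let $h=\log_2(2d)$. A quadtree is a rooted tree $T$ of depth $h$; each internal node at depth $j<h$ is labelled with an ordered tuple $(i_1,\dots,i_{2^j})\in[d]^{2^j}$ and has $2^{2^j}$ children indexed by $\{0,1\}^{2^j}$; nodes at depth $h-1$ are labelled $(1,\dots,d)$. A point $x$ determines a root-to-leaf path $\mathsf{v}_0(x),\dots,\mathsf{v}_h(x)$: from a node at depth $j$ labelled $(i_1,\dots,i_{2^j})$ go to its $(x_{i_1},\dots,x_{i_{2^j}})$-child. For a node $v$ at depth $i$, $X_v=\{x\in X:\mathsf{v}_i(x)=v\}$; $L_i$ is the set of depth-$i$ nodes with $X_v\ne\emptyset$; $\pi(v)$ is the parent of $v$. For an edge $(u,v)$, $\mathrm{avg}_{u,v}=\mathbb{E}_{c\sim X_u,c'\sim X_v}\|c-c'\|_1$ (uniform), $0$ if $X_v=\emptyset$. $\mathrm{Value}_T(X)=\sum_{i=1}^{h}\mathbf{1}\{|L_i|>1\}\sum_{v\in L_i}\mathrm{avg}_{\pi(v),v}$. For $x,y\in X$, $\mathrm{Pay}_T(x,y)=\sum_{i=1}^h\mathbf{1}\{\mathsf{v}_i(x)\ne\mathsf{v}_i(y)\}\big(\mathrm{avg}_{x,i-1}+\mathrm{avg}_{y,i-1}\big)$ with $\mathrm{avg}_{x,i-1}=\mathbb{E}_{c\sim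 X_{\mathsf{v}_{i-1}(x)}}\|x-c\|_1$ ($c$ uniform), and similarly for $y$. -}

module Defs where

open import Data.Nat as ℕ using (ℕ; zero; suc; _^_)
open import Data.Bool using (Bool; true; false; _xor_)
open import Data.Fin using (Fin)
open import Data.Vec as Vec using (Vec; lookup; toList)
open import Data.List as List using (List; []; _∷_; length; filter; deduplicate; upTo; map; take; foldr)
open import Data.List.Properties using (≡-dec)
open import Data.List.Membership.Propositional using (_∈_)
open import Data.Product using (_×_; _,_)
open import Data.Integer using (+_)
open import Data.Rational as ℚ using (ℚ; 0ℚ; _/_)
import Data.Bool.Properties as BoolP
import Data.Vec.Properties as VecP
open import Relation.Binary.PropositionalEquality using (_≡_; _≢_)
open import Relation.Nullary using (Dec; yes; no; ¬?)
open import Relation.Nullary.Decidable using (⌊_⌋)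

-- Dimension d = 2 ^ k, so h = log₂(2d) = k + 1.  Points of {0,1}^d.

Point : ℕ → Set
Point k = Vec Bool (2 ^ k)

dist : ∀ {k} → Point k → Point k → ℕ
dist x y = Vec.sum (Vec.map (λ b → if b then 1 else 0) (Vec.zipWith _xor_ x y))
  where open import Data.Bool using (if_then_else_)

-- A node at depth j (j < h) is labelled by a tuple in
-- [d]^(2^j) (coordinates are 0-indexed: Fin d) and has 2^(2^j) children
-- indexed by {0,1}^(2^j).  Nodes at depth h-1 = k carry the fixed label
-- (1,…,d) (constructor 'last'); their children are the leaves (depth h).

data Node (k : ℕ) : ℕ → Set where
  last  : Node k k
  inner : ∀ {j} → Vec (Fin (2 ^ k)) (2 ^ j)
        → (Vec Bool (2 ^ j) → Node k (suc j)) → Node k j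

Quadtree : ℕ → Set
Quadtree k = Node k 0

-- A node at depth i is identified with its address: the list of child
-- indices followed from the root.
Address : Set
Address = List (List Bool)

_≟A_ : (a b : Address) → Dec (a ≡ b)
_≟A_ = ≡-dec (≡-dec BoolP._≟_)

-- address of v_i(x)  (meaningful for i ≤ h)
addr : ∀ {k j} → Node k j → Point k → ℕ → Address
addr _ x zero = []
addr last x (suc i) = toList x ∷ []
addr (inner ℓ ch) x (suc i) =
  toList (Vec.map (lookup x) ℓ) ∷ addr (ch (Vec.map (lookup x) ℓ)) x i

sumℚ : List ℚ → ℚ
sumℚ = foldr ℚ._+_ 0ℚ

sumℕ : List ℕ → ℕ
sumℕ = foldr ℕ._+_ 0

-- avg A B = E_{c∼A, c'∼B} ‖c − c'‖₁ (uniform), 0 if A or B is empty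
avg : ∀ {k : ℕ} → List (Point k) → List (Point k) → ℚ
avg [] _ = 0ℚ
avg (_ ∷ _) [] = 0ℚ
avg {k} A@(_ ∷ as) B@(_ ∷ bs) =
  (+ sumℕ (List.concatMap (λ a → map (dist {k} a) B) A))
    / (suc (length as) ℕ.* suc (length bs))

module _ {k : ℕ} (T : Quadtree k) (X : List (Point k)) where

  cell : ℕ → Address → List (Point k)
  cell i a = filter (λ c → addr T c i ≟A a) X

  L : ℕ → List Address
  L i = deduplicate _≟A_ (map (λ x → addr T x i) X)

  depths : List ℕ
  depths = map suc (upTo (suc k))

  indicator : Bool → ℚ → ℚ
  indicator true q = q
  indicator false q = 0ℚ

  Value : ℚ
  Value = sumℚ (map term depths)
    where
    term : ℕ → ℚ
    term zero = 0ℚ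
    term (suc i) =
      indicator ⌊ 1 ℕ.<? length (L (suc i)) ⌋
        (sumℚ (map (λ v → avg {k} (cell i (take i v)) (cell (suc i) v)) (L (suc i))))
      -- π(v) has address 'take i v'

  avgPt : Point k → ℕ → ℚ
  avgPt x i = avg {k} (x ∷ []) (cell i (addr T x i))

  Pay : Point k → Point k → ℚ
  Pay x y = sumℚ (map term depths)
    where
    term : ℕ → ℚ
    term zero = 0ℚ
    term (suc i) =
      indicator ⌊ ¬? (addr T x (suc i) ≟A addr T y (suc i)) ⌋
        (avgPt x i ℚ.+ avgPt y i)

-- Spanning trees of X: edge lists with endpoints in X, no loops,
-- connected, with exactly |X| − 1 edges (a connected graph on n vertices
-- with n − 1 edges is a tree).

Edge : ℕ → Set
Edge k = Point k × Point k

data Walk (k : ℕ) (E : List (Edge k)) : Point k → Point k → Set where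
  here : ∀ {x} → Walk k E x x
  fwd  : ∀ {x y z} → (x , y) ∈ E → Walk k E y z → Walk k E x z
  bwd  : ∀ {x y z} → (y , x) ∈ E → Walk k E y z → Walk k E x z

record IsSpanningTree (k : ℕ) (X : List (Point k)) (E : List (Edge k)) : Set where
  field
    endpoints : ∀ {x y} → (x , y) ∈ E → x ∈ X × y ∈ X × x ≢ y
    connected : ∀ {x y} → x ∈ X → y ∈ X → Walk k E x y
    edgeCount : length E ℕ.+ 1 ≡ length X

{-# OPTIONS --safe #-}
module Submission where

-- Fix a depth i ≥ 1 with at least two occupied cells, and an occupied cell v at depth i.  Since G
-- connects a point of v to a point of another cell, some edge (x, y) of G leaves v, and the
-- triangle inequality through x bounds avg_{π(v),v} by avg_{x,i-1} + avg_{x,i}; charge this to the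
-- edge, which is separated at depth i.  The cells of a depth are disjoint, so each endpoint is
-- charged at most once per depth.  An edge separated at depth i stays separated at depth i + 1,
-- so the charges avg_{x,i} are covered by the Pay term of depth i + 1, the last of them vanishing
-- because leaf cells are singletons.  Hence each edge is charged at most 2 Pay in total.

open import Defs
open import Data.Nat using (ℕ)
open import Data.Integer using (+_)
open import Data.List using (List; map)
open import Data.Product using (proj₁; proj₂)
open import Data.List.Relation.Unary.Unique.Propositional using (Unique)
open import Data.Rational using (_≤_; _*_; _/_)

open import Algebra.Bundles using (CommutativeMonoid)
import Algebra.Properties.CommutativeSemigroup as CommSemigroupProperties
open import Data.Bool using (Bool; true; false; _xor_; if_then_else_)
import Data.Bool.Properties as BoolP
open import Data.Empty using (⊥-elim)
import Data.Integer as ℤ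
import Data.Integer.Properties as ℤP
open import Data.List using ([]; _∷_; _++_; foldr; length; upTo; applyUpTo; take; concatMap)
import Data.List.Properties as ListP
open import Data.List.Membership.Propositional using (_∈_)
open import Data.List.Membership.Propositional.Properties using (∈-map⁻; ∈-deduplicate⁻)
open import Data.List.Relation.Unary.All as All using (All; []; _∷_)
open import Data.List.Relation.Unary.All.Properties using (all-filter)
open import Data.List.Relation.Unary.AllPairs using ([]; _∷_)
open import Data.List.Relation.Unary.Any using (here; there)
open import Data.List.Relation.Unary.Unique.DecPropositional.Properties using (deduplicate-!)
open import Data.Nat as ℕ using (zero; suc)
open import Data.Nat.ListAction.Properties using (sum-++)
import Data.Nat.Properties as ℕP
open import Data.Nat.Tactic.RingSolver using (solve-∀)
open import Data.Product using (_×_; _,_; ∃)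
open import Data.Rational as ℚ using (ℚ; 0ℚ; 1ℚ; toℚᵘ; fromℚᵘ)
import Data.Rational.Properties as ℚP
open import Data.Rational.Unnormalised as ℚᵘ using (ℚᵘ; mkℚᵘ; *≤*)
import Data.Rational.Unnormalised.Properties as ℚᵘP
open import Data.Sum using (_⊎_; inj₁; inj₂)
open import Data.Vec as Vec using (Vec; []; _∷_)
import Data.Vec.Properties as VecP
open import Function using (_∘_; case_of_)
open import Relation.Binary.Definitions using (DecidableEquality)
open import Relation.Binary.PropositionalEquality
open import Relation.Nullary using (Dec; yes; no; ¬_; ¬?; contradiction)
open import Relation.Nullary.Decidable using (⌊_⌋; isYes≗does; dec-true; dec-false)
import Relation.Unary as U

module ℕ+ = CommSemigroupProperties ℕP.+-commutativeSemigroup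
module ℚ+ = CommSemigroupProperties (CommutativeMonoid.commutativeSemigroup ℚP.+-0-commutativeMonoid)

+-nonNeg : ∀ {p q} → 0ℚ ≤ p → 0ℚ ≤ q → 0ℚ ≤ p ℚ.+ q
+-nonNeg {p} {q} 0≤p 0≤q = subst (_≤ p ℚ.+ q) (ℚP.+-identityʳ 0ℚ) (ℚP.+-mono-≤ 0≤p 0≤q)

p≤p+q : ∀ p {q} → 0ℚ ≤ q → p ≤ p ℚ.+ q
p≤p+q p {q} 0≤q = subst (_≤ p ℚ.+ q) (ℚP.+-identityʳ p) (ℚP.+-monoʳ-≤ p 0≤q)

p≤q+p : ∀ p {q} → 0ℚ ≤ q → p ≤ q ℚ.+ p
p≤q+p p {q} 0≤q = subst (p ≤_) (ℚP.+-comm p q) (p≤p+q p 0≤q)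

module _ {A : Set} where

  sumℚ-nonNeg : ∀ (f : A → ℚ) l → (∀ a → 0ℚ ≤ f a) → 0ℚ ≤ sumℚ (map f l)
  sumℚ-nonNeg f []      0≤f = ℚP.≤-refl
  sumℚ-nonNeg f (a ∷ l) 0≤f = +-nonNeg (0≤f a) (sumℚ-nonNeg f l 0≤f)

  sumℚ-mono-≤ : ∀ {f g : A → ℚ} l → (∀ {a} → a ∈ l → f a ≤ g a) →
                sumℚ (map f l) ≤ sumℚ (map g l)
  sumℚ-mono-≤ []      f≤g = ℚP.≤-refl
  sumℚ-mono-≤ (a ∷ l) f≤g = ℚP.+-mono-≤ (f≤g (here refl)) (sumℚ-mono-≤ l (f≤g ∘ there))

  sumℚ-zero : ∀ {f : A → ℚ} l → (∀ {a} → a ∈ l → f a ≡ 0ℚ) → sumℚ (map f l) ≡ 0ℚ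
  sumℚ-zero []      f≡0 = refl
  sumℚ-zero (a ∷ l) f≡0 = trans (cong₂ ℚ._+_ (f≡0 (here refl)) (sumℚ-zero l (f≡0 ∘ there)))
                                (ℚP.+-identityʳ 0ℚ)

  sumℚ-+ : ∀ (f g : A → ℚ) l →
           sumℚ (map (λ a → f a ℚ.+ g a) l) ≡ sumℚ (map f l) ℚ.+ sumℚ (map g l)
  sumℚ-+ f g []      = sym (ℚP.+-identityʳ 0ℚ)
  sumℚ-+ f g (a ∷ l) = trans (cong (f a ℚ.+ g a ℚ.+_) (sumℚ-+ f g l)) (ℚ+.interchange (f a) (g a) _ _)

  ≤-sumℚ : ∀ (f : A → ℚ) {l a} → (∀ b → 0ℚ ≤ f b) → a ∈ l → f a ≤ sumℚ (map f l)
  ≤-sumℚ f {b ∷ l} 0≤f (here refl) = p≤p+q (f b) (sumℚ-nonNeg f l 0≤f)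
  ≤-sumℚ f {b ∷ l} 0≤f (there a∈l) = ℚP.≤-trans (≤-sumℚ f 0≤f a∈l) (p≤q+p _ (0≤f b))

sumℚ-comm : ∀ {A B : Set} (F : A → B → ℚ) as bs →
            sumℚ (map (λ a → sumℚ (map (F a) bs)) as) ≡ sumℚ (map (λ b → sumℚ (map (λ a → F a b) as)) bs)
sumℚ-comm F []       bs = sym (sumℚ-zero bs (λ _ → refl))
sumℚ-comm F (a ∷ as) bs = trans (cong (sumℚ (map (F a) bs) ℚ.+_) (sumℚ-comm F as bs))
                                (sym (sumℚ-+ (F a) _ bs))

sumℚ-upTo-suc : ∀ (t : ℕ → ℚ) n →
                sumℚ (map t (upTo (suc n))) ≡ t 0 ℚ.+ sumℚ (map (t ∘ suc) (upTo n))
sumℚ-upTo-suc t n = cong (λ ts → t 0 ℚ.+ sumℚ ts)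
  (trans (ListP.map-applyUpTo suc t n) (sym (ListP.map-upTo (t ∘ suc) n)))

sumℚ-upTo-last : ∀ (t : ℕ → ℚ) n → t n ≡ 0ℚ →
                 sumℚ (map t (upTo (suc n))) ≡ sumℚ (map t (upTo n))
sumℚ-upTo-last t n tn≡0 = begin
  sumℚ (map t (upTo (suc n)))               ≡⟨ cong (sumℚ ∘ map t) (ListP.upTo-∷ʳ n) ⟨
  sumℚ (map t (upTo n ++ n ∷ []))           ≡⟨ cong sumℚ (ListP.map-++ t (upTo n) (n ∷ [])) ⟩
  sumℚ (map t (upTo n) ++ t n ∷ [])         ≡⟨ ListP.foldr-++ ℚ._+_ 0ℚ (map t (upTo n)) (t n ∷ []) ⟩
  foldr ℚ._+_ (t n ℚ.+ 0ℚ) (map t (upTo n)) ≡⟨ cong (λ z → foldr ℚ._+_ z (map t (upTo n))) last≡0 ⟩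
  sumℚ (map t (upTo n))                     ∎
  where
  open ≡-Reasoning
  last≡0 : t n ℚ.+ 0ℚ ≡ 0ℚ
  last≡0 = trans (ℚP.+-identityʳ (t n)) tn≡0

sumℚ-upTo-≤-shifted : ∀ (t u : ℕ → ℚ) n → (∀ i → t i ≤ u (suc i)) → (∀ i → 0ℚ ≤ u i) → u n ≡ 0ℚ →
                      sumℚ (map t (upTo n)) ≤ sumℚ (map u (upTo n))
sumℚ-upTo-≤-shifted t u n t≤u₊ 0≤u un≡0 = begin
  sumℚ (map t (upTo n))                    ≤⟨ sumℚ-mono-≤ (upTo n) (λ {i} _ → t≤u₊ i) ⟩
  sumℚ (map (u ∘ suc) (upTo n))            ≤⟨ p≤q+p _ (0≤u 0) ⟩
  u 0 ℚ.+ sumℚ (map (u ∘ suc) (upTo n))    ≡⟨ sumℚ-upTo-suc u n ⟨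
  sumℚ (map u (upTo (suc n)))              ≡⟨ sumℚ-upTo-last u n un≡0 ⟩
  sumℚ (map u (upTo n))                    ∎
  where open ℚP.≤-Reasoning

toList-injective : ∀ {A : Set} {n} {u w : Vec A n} → Vec.toList u ≡ Vec.toList w → u ≡ w
toList-injective {u = u} {w} eq = trans (sym (VecP.cast-is-id refl u)) (VecP.toList-injective refl u w eq)

hamming : ∀ {n} → Vec Bool n → Vec Bool n → ℕ
hamming x y = Vec.sum (Vec.map (λ b → if b then 1 else 0) (Vec.zipWith _xor_ x y))

private
  bit : Bool → ℕ
  bit b = if b then 1 else 0

  bit-triangle : ∀ a b c → bit (a xor c) ℕ.≤ bit (a xor b) ℕ.+ bit (b xor c)
  bit-triangle false false false = ℕ.z≤n
  bit-triangle false false true  = ℕP.≤-refl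
  bit-triangle false true  false = ℕ.z≤n
  bit-triangle false true  true  = ℕ.s≤s ℕ.z≤n
  bit-triangle true  false false = ℕ.s≤s ℕ.z≤n
  bit-triangle true  false true  = ℕ.z≤n
  bit-triangle true  true  false = ℕP.≤-refl
  bit-triangle true  true  true  = ℕ.z≤n

hamming-refl : ∀ {n} (x : Vec Bool n) → hamming x x ≡ 0
hamming-refl []      = refl
hamming-refl (a ∷ x) = cong₂ ℕ._+_ (cong bit (BoolP.xor-same a)) (hamming-refl x)

hamming-sym : ∀ {n} (x y : Vec Bool n) → hamming x y ≡ hamming y x
hamming-sym []      []      = refl
hamming-sym (a ∷ x) (b ∷ y) = cong₂ ℕ._+_ (cong bit (BoolP.xor-comm a b)) (hamming-sym x y)

hamming-triangle : ∀ {n} (x y z : Vec Bool n) → hamming x z ℕ.≤ hamming x y ℕ.+ hamming y z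
hamming-triangle []      []      []      = ℕ.z≤n
hamming-triangle (a ∷ x) (b ∷ y) (c ∷ z) = ℕP.≤-trans
  (ℕP.+-mono-≤ (bit-triangle a b c) (hamming-triangle x y z))
  (ℕP.≤-reflexive (ℕ+.interchange (bit (a xor b)) (bit (b xor c)) _ _))

module _ {n : ℕ} where

  private
    d : Vec Bool n → Vec Bool n → ℕ
    d = hamming

  sum-hamming-row : ∀ z a (V : List (Vec Bool n)) →
                    sumℕ (map (d a) V) ℕ.≤ length V ℕ.* d z a ℕ.+ sumℕ (map (d z) V)
  sum-hamming-row z a []      = ℕ.z≤n
  sum-hamming-row z a (b ∷ V) = begin
    d a b ℕ.+ sumℕ (map (d a) V)
      ≤⟨ ℕP.+-mono-≤ via-z (sum-hamming-row z a V) ⟩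
    (d z a ℕ.+ d z b) ℕ.+ (length V ℕ.* d z a ℕ.+ sumℕ (map (d z) V))
      ≡⟨ rearrange (d z a) (d z b) (length V) (sumℕ (map (d z) V)) ⟩
    suc (length V) ℕ.* d z a ℕ.+ (d z b ℕ.+ sumℕ (map (d z) V)) ∎
    where
    open ℕP.≤-Reasoning
    via-z : d a b ℕ.≤ d z a ℕ.+ d z b
    via-z = subst (λ m → d a b ℕ.≤ m ℕ.+ d z b) (hamming-sym a z) (hamming-triangle a z b)
    rearrange : ∀ p q l s → (p ℕ.+ q) ℕ.+ (l ℕ.* p ℕ.+ s) ≡ suc l ℕ.* p ℕ.+ (q ℕ.+ s)
    rearrange = solve-∀

  sum-hamming-pairs : ∀ z (U V : List (Vec Bool n)) →
                      sumℕ (concatMap (λ a → map (d a) V) U)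
                        ℕ.≤ sumℕ (map (d z) U) ℕ.* length V ℕ.+ sumℕ (map (d z) V) ℕ.* length U
  sum-hamming-pairs z []      V = ℕ.z≤n
  sum-hamming-pairs z (a ∷ U) V = begin
    sumℕ (map (d a) V ++ concatMap (λ a → map (d a) V) U)
      ≡⟨ sum-++ (map (d a) V) _ ⟩
    sumℕ (map (d a) V) ℕ.+ sumℕ (concatMap (λ a → map (d a) V) U)
      ≤⟨ ℕP.+-mono-≤ (sum-hamming-row z a V) (sum-hamming-pairs z U V) ⟩
    (length V ℕ.* d z a ℕ.+ sumℕ (map (d z) V))
      ℕ.+ (sumℕ (map (d z) U) ℕ.* length V ℕ.+ sumℕ (map (d z) V) ℕ.* length U)
      ≡⟨ rearrange (d z a) (length V) (sumℕ (map (d z) V)) (sumℕ (map (d z) U)) (length U) ⟩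
    (d z a ℕ.+ sumℕ (map (d z) U)) ℕ.* length V ℕ.+ sumℕ (map (d z) V) ℕ.* suc (length U) ∎
    where
    open ℕP.≤-Reasoning
    rearrange : ∀ p l s t m → (l ℕ.* p ℕ.+ s) ℕ.+ (t ℕ.* l ℕ.+ s ℕ.* m) ≡ (p ℕ.+ t) ℕ.* l ℕ.+ s ℕ.* suc m
    rearrange = solve-∀

fromℚᵘ-mono-≤ : ∀ {p q} → p ℚᵘ.≤ q → fromℚᵘ p ≤ fromℚᵘ q
fromℚᵘ-mono-≤ {p} {q} p≤q = ℚP.toℚᵘ-cancel-≤
  (ℚᵘP.≤-respˡ-≃ (ℚᵘP.≃-sym (ℚP.toℚᵘ-fromℚᵘ p)) (ℚᵘP.≤-respʳ-≃ (ℚᵘP.≃-sym (ℚP.toℚᵘ-fromℚᵘ q)) p≤q))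

fromℚᵘ-homo-+ : ∀ p q → fromℚᵘ (p ℚᵘ.+ q) ≡ fromℚᵘ p ℚ.+ fromℚᵘ q
fromℚᵘ-homo-+ p q = ℚP.toℚᵘ-injective (begin
  toℚᵘ (fromℚᵘ (p ℚᵘ.+ q))                ≈⟨ ℚP.toℚᵘ-fromℚᵘ (p ℚᵘ.+ q) ⟩
  p ℚᵘ.+ q                                ≈⟨ ℚᵘP.+-cong (ℚᵘP.≃-sym (ℚP.toℚᵘ-fromℚᵘ p))
                                                          (ℚᵘP.≃-sym (ℚP.toℚᵘ-fromℚᵘ q)) ⟩
  toℚᵘ (fromℚᵘ p) ℚᵘ.+ toℚᵘ (fromℚᵘ q)    ≈⟨ ℚP.toℚᵘ-homo-+ (fromℚᵘ p) (fromℚᵘ q) ⟨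
  toℚᵘ (fromℚᵘ p ℚ.+ fromℚᵘ q)            ∎)
  where open ℚᵘP.≃-Reasoning

s/[ab]≤s₁/a+s₂/b : ∀ s s₁ s₂ a b → s ℕ.≤ s₁ ℕ.* suc b ℕ.+ s₂ ℕ.* suc a →
          (+ s) / (suc a ℕ.* suc b) ≤ (+ s₁) / suc a ℚ.+ (+ s₂) / suc b
s/[ab]≤s₁/a+s₂/b s s₁ s₂ a b s≤ = begin
  fromℚᵘ p                               ≤⟨ fromℚᵘ-mono-≤ {p} {q₁ ℚᵘ.+ q₂}
                                               (*≤* (ℤP.*-monoʳ-≤-nonNeg (+ (suc a ℕ.* suc b)) s≤′)) ⟩
  fromℚᵘ (q₁ ℚᵘ.+ q₂)                    ≡⟨ fromℚᵘ-homo-+ q₁ q₂ ⟩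
  (+ s₁) / suc a ℚ.+ (+ s₂) / suc b      ∎
  where
  open ℚP.≤-Reasoning
  p q₁ q₂ : ℚᵘ
  p  = mkℚᵘ (+ s) (b ℕ.+ a ℕ.* suc b)
  q₁ = mkℚᵘ (+ s₁) a
  q₂ = mkℚᵘ (+ s₂) b
  s≤′ : + s ℤ.≤ + s₁ ℤ.* + suc b ℤ.+ + s₂ ℤ.* + suc a
  s≤′ = subst (+ s ℤ.≤_)
          (trans (ℤP.pos-+ (s₁ ℕ.* suc b) _) (cong₂ ℤ._+_ (ℤP.pos-* s₁ (suc b)) (ℤP.pos-* s₂ (suc a))))
          (ℤ.+≤+ s≤)

module _ {k : ℕ} where

  avg-nonNeg : ∀ (U V : List (Point k)) → 0ℚ ≤ avg {k} U V
  avg-nonNeg []            _            = ℚP.≤-refl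
  avg-nonNeg (_ ∷ _)       []           = ℚP.≤-refl
  avg-nonNeg U@(_ ∷ us)    V@(_ ∷ vs)   = ℚP.nonNegative⁻¹ _
    {{ℚP.normalize-nonNeg (sumℕ (concatMap (λ a → map (dist {k} a) V) U)) (suc (length us) ℕ.* suc (length vs))}}

  avg-singleton : ∀ z w ws →
                  avg {k} (z ∷ []) (w ∷ ws) ≡ (+ sumℕ (map (dist {k} z) (w ∷ ws))) / suc (length ws)
  avg-singleton z w ws = ℚP./-cong (cong (+_ ∘ sumℕ) (ListP.++-identityʳ (map (dist {k} z) (w ∷ ws))))
                                   (ℕP.*-identityˡ (suc (length ws)))

  -- avg is 0 when U or V is empty, so z need not belong to either.
  avg-triangle : ∀ z (U V : List (Point k)) → avg {k} U V ≤ avg {k} (z ∷ []) U ℚ.+ avg {k} (z ∷ []) V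
  avg-triangle z U@(u ∷ us) V@(v ∷ vs) = begin
    avg {k} U V
      ≤⟨ s/[ab]≤s₁/a+s₂/b _ (sumℕ (map (dist {k} z) U)) (sumℕ (map (dist {k} z) V))
                            (length us) (length vs) (sum-hamming-pairs z U V) ⟩
    (+ sumℕ (map (dist {k} z) U)) / suc (length us) ℚ.+ (+ sumℕ (map (dist {k} z) V)) / suc (length vs)
      ≡⟨ cong₂ ℚ._+_ (avg-singleton z u us) (avg-singleton z v vs) ⟨
    avg {k} (z ∷ []) U ℚ.+ avg {k} (z ∷ []) V ∎
    where open ℚP.≤-Reasoning
  avg-triangle z []      V  = +-nonNeg (avg-nonNeg (z ∷ []) []) (avg-nonNeg (z ∷ []) V)
  avg-triangle z (u ∷ U) [] = +-nonNeg (avg-nonNeg (z ∷ []) (u ∷ U)) (avg-nonNeg (z ∷ []) [])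

  avg-singleton-zero : ∀ x (W : List (Point k)) → All (_≡ x) W → avg {k} (x ∷ []) W ≡ 0ℚ
  avg-singleton-zero x []       _   = refl
  avg-singleton-zero x (w ∷ ws) W≡x = begin
    avg {k} (x ∷ []) (w ∷ ws)                              ≡⟨ avg-singleton x w ws ⟩
    (+ sumℕ (map (dist {k} x) (w ∷ ws))) / suc (length ws) ≡⟨ ℚP./-cong (cong +_ (sum≡0 W≡x)) refl ⟩
    (+ 0) / suc (length ws)                                ≡⟨ ℚP.0/n≡0 (suc (length ws)) ⟩
    0ℚ                                                     ∎
    where
    open ≡-Reasoning
    sum≡0 : ∀ {W} → All (_≡ x) W → sumℕ (map (dist {k} x) W) ≡ 0
    sum≡0 []           = refl
    sum≡0 (refl ∷ W≡x) = cong₂ ℕ._+_ (hamming-refl x) (sum≡0 W≡x)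

module _ {k : ℕ} where

  addr-take : ∀ {j} (n : Node k j) x i → take i (addr n x (suc i)) ≡ addr n x i
  addr-take n            x zero          = refl
  addr-take last         x (suc zero)    = refl
  addr-take last         x (suc (suc i)) = refl
  addr-take (inner ℓ ch) x (suc i)       = cong (_ ∷_) (addr-take (ch _) x i)

  addr-≡-pred : ∀ {j} (n : Node k j) x y i → addr n x (suc i) ≡ addr n y (suc i) → addr n x i ≡ addr n y i
  addr-≡-pred n x y i eq = begin
    addr n x i                 ≡⟨ addr-take n x i ⟨
    take i (addr n x (suc i))  ≡⟨ cong (take i) eq ⟩
    take i (addr n y (suc i))  ≡⟨ addr-take n y i ⟩
    addr n y i                 ∎
    where open ≡-Reasoning

  depth≤height : ∀ {j} → Node k j → j ℕ.≤ k
  depth≤height last         = ℕP.≤-refl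
  depth≤height (inner ℓ ch) = ℕP.<⇒≤ (depth≤height (ch (Vec.replicate _ false)))

  addr-injective : ∀ {j} (n : Node k j) i → i ℕ.+ j ≡ suc k →
                   ∀ {x y} → addr n x i ≡ addr n y i → x ≡ y
  addr-injective last         zero    k≡1+k _ = ⊥-elim (ℕP.1+n≢n (sym k≡1+k))
  addr-injective (inner ℓ ch) zero    j≡1+k _ =
    ⊥-elim (ℕP.1+n≰n (subst (ℕ._≤ k) j≡1+k (depth≤height (inner ℓ ch))))
  addr-injective last         (suc i) _ {x} {y} eq = toList-injective (ListP.∷-injectiveˡ eq)
  addr-injective (inner ℓ ch) (suc i) i+j≡1+k {x} {y} eq =
    addr-injective (ch xℓ) i (trans (ℕP.+-suc i _) i+j≡1+k)
      (trans (ListP.∷-injectiveʳ eq) (cong (λ w → addr (ch w) y i) (sym xℓ≡yℓ)))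
    where
    xℓ : Vec Bool _
    xℓ = Vec.map (Vec.lookup x) ℓ
    xℓ≡yℓ : xℓ ≡ Vec.map (Vec.lookup y) ℓ
    xℓ≡yℓ = toList-injective (ListP.∷-injectiveˡ eq)

  Crosses : (Point k → Set) → Edge k → Set
  Crosses P e = (P (proj₁ e) × ¬ P (proj₂ e)) ⊎ (P (proj₂ e) × ¬ P (proj₁ e))

  walk-crossing : ∀ {E P} → U.Decidable P → ∀ {x z} → Walk k E x z → P x → ¬ P z →
                  ∃ λ e → e ∈ E × Crosses P e
  walk-crossing P? here                Px ¬Pz = contradiction Px ¬Pz
  walk-crossing P? (fwd {x} {y} xy∈E w) Px ¬Pz with P? y
  ... | yes Py = walk-crossing P? w Py ¬Pz
  ... | no ¬Py = (x , y) , xy∈E , inj₁ (Px , ¬Py)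
  walk-crossing P? (bwd {x} {y} yx∈E w) Px ¬Pz with P? y
  ... | yes Py = walk-crossing P? w Py ¬Pz
  ... | no ¬Py = (y , x) , yx∈E , inj₂ (Px , ¬Py)

Unique-∃-≢ : ∀ {A : Set} → DecidableEquality A → ∀ {xs : List A} → Unique xs → 1 ℕ.< length xs →
             ∀ v → ∃ λ w → w ∈ xs × w ≢ v
Unique-∃-≢ _≟_ {a ∷ b ∷ _} ((a≢b ∷ _) ∷ _) _ v with a ≟ v
... | yes refl = b , there (here refl) , a≢b ∘ sym
... | no a≢v   = a , here refl , a≢v
Unique-∃-≢ _≟_ {_ ∷ []} _ (ℕ.s≤s ()) v

isYes-true : ∀ {P : Set} (p? : Dec P) → P → ⌊ p? ⌋ ≡ true
isYes-true p? p = trans (isYes≗does p?) (dec-true p? p)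

isYes-false : ∀ {P : Set} (p? : Dec P) → ¬ P → ⌊ p? ⌋ ≡ false
isYes-false p? ¬p = trans (isYes≗does p?) (dec-false p? ¬p)

module _ {k : ℕ} (T : Quadtree k) (X : List (Point k)) where

  private
    [_]·_ : Bool → ℚ → ℚ
    [_]·_ = indicator T X

  indicator-nonNeg : ∀ b {q} → 0ℚ ≤ q → 0ℚ ≤ [ b ]· q
  indicator-nonNeg true  0≤q = 0≤q
  indicator-nonNeg false _   = ℚP.≤-refl

  indicator-mono-≤ : ∀ b {q r} → q ≤ r → [ b ]· q ≤ [ b ]· r
  indicator-mono-≤ true  q≤r = q≤r
  indicator-mono-≤ false _   = ℚP.≤-refl

  indicator-≤-implies : ∀ {b c q} → (b ≡ true → c ≡ true) → 0ℚ ≤ q → [ b ]· q ≤ [ c ]· q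
  indicator-≤-implies {false} {c}    _   0≤q = indicator-nonNeg c 0≤q
  indicator-≤-implies {true}  {true} _   _   = ℚP.≤-refl
  indicator-≤-implies {true}  {false} b⇒c _  = contradiction (b⇒c refl) λ ()

  indicator-0 : ∀ b → [ b ]· 0ℚ ≡ 0ℚ
  indicator-0 true  = refl
  indicator-0 false = refl

  indicator-+ : ∀ b p q → [ b ]· (p ℚ.+ q) ≡ [ b ]· p ℚ.+ [ b ]· q
  indicator-+ true  p q = refl
  indicator-+ false p q = sym (ℚP.+-identityʳ 0ℚ)

  indicator-sumℚ : ∀ {A : Set} b (f : A → ℚ) l → sumℚ (map (λ a → [ b ]· f a) l) ≡ [ b ]· sumℚ (map f l)
  indicator-sumℚ true  f l = refl
  indicator-sumℚ false f l = sumℚ-zero l (λ _ → refl)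

  -- The i-th level of avgToParent, levelTerm, payTerm and crossingCost is depth i + 1, the
  -- depth of the cells v (Value and Pay sum over the depths 1, …, h).
  avgToParent : ℕ → Address → ℚ
  avgToParent i v = avg {k} (cell T X i (take i v)) (cell T X (suc i) v)

  levelTerm : ℕ → ℚ
  levelTerm i = [ ⌊ 1 ℕ.<? length (L T X (suc i)) ⌋ ]· sumℚ (map (avgToParent i) (L T X (suc i)))

  separated : ℕ → Edge k → Bool
  separated ℓ e = ⌊ ¬? (addr T (proj₁ e) ℓ ≟A addr T (proj₂ e) ℓ) ⌋

  edgeCost : ℕ → Edge k → ℚ
  edgeCost i e = avgPt T X (proj₁ e) i ℚ.+ avgPt T X (proj₂ e) i

  payTerm : Edge k → ℕ → ℚ
  payTerm e i = [ separated (suc i) e ]· edgeCost i e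

  Value-levels : Value T X ≡ sumℚ (map levelTerm (upTo (suc k)))
  Value-levels = cong (levelTerm 0 ℚ.+_) (cong sumℚ (sym (ListP.map-∘ (applyUpTo suc k))))

  Pay-levels : ∀ e → Pay T X (proj₁ e) (proj₂ e) ≡ sumℚ (map (payTerm e) (upTo (suc k)))
  Pay-levels e = cong (payTerm e 0 ℚ.+_) (cong sumℚ (sym (ListP.map-∘ (applyUpTo suc k))))

  avgPt-nonNeg : ∀ x i → 0ℚ ≤ avgPt T X x i
  avgPt-nonNeg x i = avg-nonNeg {k} (x ∷ []) (cell T X i (addr T x i))

  edgeCost-nonNeg : ∀ i e → 0ℚ ≤ edgeCost i e
  edgeCost-nonNeg i e = +-nonNeg (avgPt-nonNeg (proj₁ e) i) (avgPt-nonNeg (proj₂ e) i)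

  payTerm-nonNeg : ∀ e i → 0ℚ ≤ payTerm e i
  payTerm-nonNeg e i = indicator-nonNeg (separated (suc i) e) (edgeCost-nonNeg i e)

  separated-true : ∀ ℓ {x y} → addr T x ℓ ≢ addr T y ℓ → separated ℓ (x , y) ≡ true
  separated-true ℓ {x} {y} = isYes-true (¬? (addr T x ℓ ≟A addr T y ℓ))

  separated-false : ∀ ℓ {x y} → addr T x ℓ ≡ addr T y ℓ → separated ℓ (x , y) ≡ false
  separated-false ℓ {x} {y} eq = isYes-false (¬? (addr T x ℓ ≟A addr T y ℓ)) (λ x≢y → x≢y eq)

  separated-suc : ∀ ℓ e → separated ℓ e ≡ true → separated (suc ℓ) e ≡ true
  separated-suc ℓ (x , y) sep = separated-true (suc ℓ) λ eq₊ →
    contradiction (trans (sym sep) (separated-false ℓ (addr-≡-pred T x y ℓ eq₊))) λ ()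

  avgPt-leaf : ∀ x → avgPt T X x (suc k) ≡ 0ℚ
  avgPt-leaf x = avg-singleton-zero {k} x (cell T X (suc k) (addr T x (suc k)))
    (All.map (addr-injective T (suc k) (ℕP.+-identityʳ (suc k)))
             (all-filter (λ c → addr T c (suc k) ≟A addr T x (suc k)) X))

  edgeCost-leaf : ∀ e → edgeCost (suc k) e ≡ 0ℚ
  edgeCost-leaf (x , y) = trans (cong₂ ℚ._+_ (avgPt-leaf x) (avgPt-leaf y)) (ℚP.+-identityʳ 0ℚ)

  crossingCost : ℕ → Edge k → ℚ
  crossingCost i e = [ separated (suc i) e ]· (edgeCost i e ℚ.+ edgeCost (suc i) e)

  sumℚ-crossingCost≤Pay+Pay : ∀ e → sumℚ (map (λ i → crossingCost i e) (upTo (suc k)))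
                                    ≤ Pay T X (proj₁ e) (proj₂ e) ℚ.+ Pay T X (proj₁ e) (proj₂ e)
  sumℚ-crossingCost≤Pay+Pay e = begin
    sumℚ (map (λ i → crossingCost i e) (upTo (suc k)))
      ≡⟨ cong sumℚ (ListP.map-cong (λ i → indicator-+ (separated (suc i) e) _ _) (upTo (suc k))) ⟩
    sumℚ (map (λ i → payTerm e i ℚ.+ nextTerm i) (upTo (suc k)))
      ≡⟨ sumℚ-+ (payTerm e) nextTerm (upTo (suc k)) ⟩
    sumℚ (map (payTerm e) (upTo (suc k))) ℚ.+ sumℚ (map nextTerm (upTo (suc k)))
      ≤⟨ ℚP.+-monoʳ-≤ (sumℚ (map (payTerm e) (upTo (suc k))))
           (sumℚ-upTo-≤-shifted nextTerm (payTerm e) (suc k)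
                                nextTerm≤payTerm (payTerm-nonNeg e) payTerm-leaf) ⟩
    sumℚ (map (payTerm e) (upTo (suc k))) ℚ.+ sumℚ (map (payTerm e) (upTo (suc k)))
      ≡⟨ cong₂ ℚ._+_ (Pay-levels e) (Pay-levels e) ⟨
    Pay T X (proj₁ e) (proj₂ e) ℚ.+ Pay T X (proj₁ e) (proj₂ e) ∎
    where
    open ℚP.≤-Reasoning
    nextTerm : ℕ → ℚ
    nextTerm i = [ separated (suc i) e ]· edgeCost (suc i) e
    nextTerm≤payTerm : ∀ i → nextTerm i ≤ payTerm e (suc i)
    nextTerm≤payTerm i = indicator-≤-implies (separated-suc (suc i) e) (edgeCost-nonNeg (suc i) e)
    payTerm-leaf : payTerm e (suc k) ≡ 0ℚ
    payTerm-leaf = trans (cong ([ separated (suc (suc k)) e ]·_) (edgeCost-leaf e))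
                         (indicator-0 (separated (suc (suc k)) e))

  stepCost : ℕ → Point k → ℚ
  stepCost i x = avgPt T X x i ℚ.+ avgPt T X x (suc i)

  stepCost-nonNeg : ∀ i x → 0ℚ ≤ stepCost i x
  stepCost-nonNeg i x = +-nonNeg (avgPt-nonNeg x i) (avgPt-nonNeg x (suc i))

  avgToParent≤stepCost : ∀ i x → avgToParent i (addr T x (suc i)) ≤ stepCost i x
  avgToParent≤stepCost i x =
    subst (λ a → avg {k} (cell T X i a) (cell T X (suc i) (addr T x (suc i))) ≤ stepCost i x)
          (sym (addr-take T x i))
          (avg-triangle {k} x (cell T X i (addr T x i)) (cell T X (suc i) (addr T x (suc i))))

  charge : ℕ → Address → Point k → ℚ
  charge i v x = [ ⌊ addr T x (suc i) ≟A v ⌋ ]· stepCost i x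

  charge-nonNeg : ∀ i v x → 0ℚ ≤ charge i v x
  charge-nonNeg i v x = indicator-nonNeg ⌊ addr T x (suc i) ≟A v ⌋ (stepCost-nonNeg i x)

  charge-in : ∀ i {v} x → addr T x (suc i) ≡ v → charge i v x ≡ stepCost i x
  charge-in i {v} x x∈v = cong ([_]· stepCost i x) (isYes-true (addr T x (suc i) ≟A v) x∈v)

  charge-out : ∀ i {v} x → addr T x (suc i) ≢ v → charge i v x ≡ 0ℚ
  charge-out i {v} x x∉v = cong ([_]· stepCost i x) (isYes-false (addr T x (suc i) ≟A v) x∉v)

  sumℚ-charge≤stepCost : ∀ i x {vs} → Unique vs → sumℚ (map (λ v → charge i v x) vs) ≤ stepCost i x
  sumℚ-charge≤stepCost i x {[]}     []            = stepCost-nonNeg i x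
  sumℚ-charge≤stepCost i x {v ∷ vs} (v∉vs ∷ vs!) = case addr T x (suc i) ≟A v of λ where
      (yes x∈v) → ℚP.≤-reflexive (begin
        charge i v x ℚ.+ rest ≡⟨ cong₂ ℚ._+_ (charge-in i x x∈v) (rest≡0 x∈v) ⟩
        stepCost i x ℚ.+ 0ℚ   ≡⟨ ℚP.+-identityʳ (stepCost i x) ⟩
        stepCost i x          ∎)
      (no x∉v) → ℚP.≤-trans
        (ℚP.≤-reflexive (trans (cong (ℚ._+ rest) (charge-out i x x∉v)) (ℚP.+-identityˡ rest)))
        (sumℚ-charge≤stepCost i x vs!)
    where
    open ≡-Reasoning
    rest : ℚ
    rest = sumℚ (map (λ w → charge i w x) vs)
    rest≡0 : addr T x (suc i) ≡ v → rest ≡ 0ℚ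
    rest≡0 x∈v = sumℚ-zero vs (λ w∈vs → charge-out i x (All.lookup v∉vs w∈vs ∘ trans (sym x∈v)))

  avgToParent≤charge : ∀ i x {v} → addr T x (suc i) ≡ v → avgToParent i v ≤ charge i v x
  avgToParent≤charge i x refl =
    ℚP.≤-trans (avgToParent≤stepCost i x) (ℚP.≤-reflexive (sym (charge-in i x refl)))

  cutCharge : ℕ → Address → Edge k → ℚ
  cutCharge i v e = [ separated (suc i) e ]· (charge i v (proj₁ e) ℚ.+ charge i v (proj₂ e))

  cutCharge-nonNeg : ∀ i v e → 0ℚ ≤ cutCharge i v e
  cutCharge-nonNeg i v e = indicator-nonNeg (separated (suc i) e)
                             (+-nonNeg (charge-nonNeg i v (proj₁ e)) (charge-nonNeg i v (proj₂ e)))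

  avgToParent≤cutCharge : ∀ i v e → Crosses {k} (λ z → addr T z (suc i) ≡ v) e →
                          avgToParent i v ≤ cutCharge i v e
  avgToParent≤cutCharge i v (x , y) (inj₁ (x∈v , y∉v)) = begin
    avgToParent i v                ≤⟨ avgToParent≤charge i x x∈v ⟩
    charge i v x                   ≤⟨ p≤p+q _ (charge-nonNeg i v y) ⟩
    charge i v x ℚ.+ charge i v y  ≡⟨ cong ([_]· (charge i v x ℚ.+ charge i v y)) x|y ⟨
    cutCharge i v (x , y)          ∎
    where
    open ℚP.≤-Reasoning
    x|y : separated (suc i) (x , y) ≡ true
    x|y = separated-true (suc i) λ x≡y → y∉v (trans (sym x≡y) x∈v)
  avgToParent≤cutCharge i v (x , y) (inj₂ (y∈v , x∉v)) = begin
    avgToParent i v                ≤⟨ avgToParent≤charge i y y∈v ⟩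
    charge i v y                   ≤⟨ p≤q+p _ (charge-nonNeg i v x) ⟩
    charge i v x ℚ.+ charge i v y  ≡⟨ cong ([_]· (charge i v x ℚ.+ charge i v y)) x|y ⟨
    cutCharge i v (x , y)          ∎
    where
    open ℚP.≤-Reasoning
    x|y : separated (suc i) (x , y) ≡ true
    x|y = separated-true (suc i) λ x≡y → x∉v (trans x≡y y∈v)

  L-member : ∀ i {v} → v ∈ L T X i → ∃ λ x → x ∈ X × addr T x i ≡ v
  L-member i v∈L =
    let x , x∈X , v≡x = ∈-map⁻ (λ x → addr T x i) (∈-deduplicate⁻ _≟A_ (map (λ x → addr T x i) X) v∈L)
    in x , x∈X , sym v≡x

  L-unique : ∀ i → Unique (L T X i)
  L-unique i = deduplicate-! _≟A_ (map (λ x → addr T x i) X)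

  crossingCost-nonNeg : ∀ i e → 0ℚ ≤ crossingCost i e
  crossingCost-nonNeg i e = indicator-nonNeg (separated (suc i) e)
                              (+-nonNeg (edgeCost-nonNeg i e) (edgeCost-nonNeg (suc i) e))

  sumℚ-cutCharge≤crossingCost : ∀ i e →
                                sumℚ (map (λ v → cutCharge i v e) (L T X (suc i))) ≤ crossingCost i e
  sumℚ-cutCharge≤crossingCost i e@(x , y) = begin
    sumℚ (map (λ v → cutCharge i v e) Lᵢ)
      ≡⟨ indicator-sumℚ (separated (suc i) e) (λ v → charge i v x ℚ.+ charge i v y) Lᵢ ⟩
    [ separated (suc i) e ]· sumℚ (map (λ v → charge i v x ℚ.+ charge i v y) Lᵢ)
      ≤⟨ indicator-mono-≤ (separated (suc i) e) charges≤ ⟩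
    crossingCost i e ∎
    where
    open ℚP.≤-Reasoning
    Lᵢ : List Address
    Lᵢ = L T X (suc i)
    charges≤ : sumℚ (map (λ v → charge i v x ℚ.+ charge i v y) Lᵢ) ≤
               edgeCost i e ℚ.+ edgeCost (suc i) e
    charges≤ = begin
      sumℚ (map (λ v → charge i v x ℚ.+ charge i v y) Lᵢ)
        ≡⟨ sumℚ-+ (λ v → charge i v x) (λ v → charge i v y) Lᵢ ⟩
      sumℚ (map (λ v → charge i v x) Lᵢ) ℚ.+ sumℚ (map (λ v → charge i v y) Lᵢ)
        ≤⟨ ℚP.+-mono-≤ (sumℚ-charge≤stepCost i x (L-unique (suc i)))
                       (sumℚ-charge≤stepCost i y (L-unique (suc i))) ⟩
      stepCost i x ℚ.+ stepCost i y
        ≡⟨ ℚ+.interchange (avgPt T X x i) (avgPt T X x (suc i)) (avgPt T X y i) (avgPt T X y (suc i)) ⟩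
      edgeCost i e ℚ.+ edgeCost (suc i) e ∎

  module _ {E : List (Edge k)} (connected : ∀ {x y} → x ∈ X → y ∈ X → Walk k E x y) where

    avgToParent≤sumℚ-cutCharge : ∀ i {v} → v ∈ L T X (suc i) → 1 ℕ.< length (L T X (suc i)) →
                                 avgToParent i v ≤ sumℚ (map (cutCharge i v) E)
    avgToParent≤sumℚ-cutCharge i {v} v∈L 1<|L| =
      let x , x∈X , x∈v  = L-member (suc i) v∈L
          w , w∈L , w≢v  = Unique-∃-≢ _≟A_ (L-unique (suc i)) 1<|L| v
          y , y∈X , y∈w  = L-member (suc i) w∈L
          e , e∈E , cross = walk-crossing {k} (λ z → addr T z (suc i) ≟A v) (connected x∈X y∈X)
                                          x∈v (w≢v ∘ trans (sym y∈w))
      in ℚP.≤-trans (avgToParent≤cutCharge i v e cross)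
                    (≤-sumℚ (cutCharge i v) (cutCharge-nonNeg i v) e∈E)

    levelTerm≤sumℚ-crossingCost : ∀ i → levelTerm i ≤ sumℚ (map (crossingCost i) E)
    levelTerm≤sumℚ-crossingCost i = bound (1 ℕ.<? length Lᵢ)
      where
      Lᵢ : List Address
      Lᵢ = L T X (suc i)
      bound : (d : Dec (1 ℕ.< length Lᵢ)) →
              [ ⌊ d ⌋ ]· sumℚ (map (avgToParent i) Lᵢ) ≤ sumℚ (map (crossingCost i) E)
      bound (no _)      = sumℚ-nonNeg (crossingCost i) E (crossingCost-nonNeg i)
      bound (yes 1<|L|) = begin
        sumℚ (map (avgToParent i) Lᵢ)
          ≤⟨ sumℚ-mono-≤ Lᵢ (λ v∈L → avgToParent≤sumℚ-cutCharge i v∈L 1<|L|) ⟩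
        sumℚ (map (λ v → sumℚ (map (cutCharge i v) E)) Lᵢ)
          ≡⟨ sumℚ-comm (cutCharge i) Lᵢ E ⟩
        sumℚ (map (λ e → sumℚ (map (λ v → cutCharge i v e) Lᵢ)) E)
          ≤⟨ sumℚ-mono-≤ E (λ {e} _ → sumℚ-cutCharge≤crossingCost i e) ⟩
        sumℚ (map (crossingCost i) E) ∎
        where open ℚP.≤-Reasoning

lemma3p11 : (k : ℕ) (X : List (Point k)) → Unique X
    → (T : Quadtree k) (E : List (Edge k)) → IsSpanningTree k X E
    → Value T X ≤ (+ 2 / 1) * sumℚ (map (λ e → Pay T X (proj₁ e) (proj₂ e)) E)
lemma3p11 k X _ T E G = begin
  Value T X
    ≡⟨ Value-levels T X ⟩
  sumℚ (map (levelTerm T X) levels)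
    ≤⟨ sumℚ-mono-≤ levels (λ {i} _ → levelTerm≤sumℚ-crossingCost T X (IsSpanningTree.connected G) i) ⟩
  sumℚ (map (λ i → sumℚ (map (crossingCost T X i) E)) levels)
    ≡⟨ sumℚ-comm (crossingCost T X) levels E ⟩
  sumℚ (map (λ e → sumℚ (map (λ i → crossingCost T X i e) levels)) E)
    ≤⟨ sumℚ-mono-≤ E (λ {e} _ → sumℚ-crossingCost≤Pay+Pay T X e) ⟩
  sumℚ (map (λ e → pay e ℚ.+ pay e) E)
    ≡⟨ sumℚ-+ pay pay E ⟩
  sumℚ (map pay E) ℚ.+ sumℚ (map pay E)
    ≡⟨ p+p≡2*p (sumℚ (map pay E)) ⟩
  (+ 2 / 1) * sumℚ (map pay E) ∎
  where
  open ℚP.≤-Reasoning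
  levels : List ℕ
  levels = upTo (suc k)
  pay : Edge k → ℚ
  pay e = Pay T X (proj₁ e) (proj₂ e)
  p+p≡2*p : ∀ p → p ℚ.+ p ≡ (+ 2 / 1) * p
  p+p≡2*p p = trans (cong₂ ℚ._+_ (sym (ℚP.*-identityˡ p)) (sym (ℚP.*-identityˡ p)))
                    (sym (ℚP.*-distribʳ-+ p 1ℚ 1ℚ))
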